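{- Let $q$ be a prime power with $q\ne2$, $D,N$ integers with $N>2D\ge6$, $\Gamma$ the bilinear forms graph on the set $X$ of $D\times(N-D)$ matrices over $\mathrm{GF}(q)$, $x,y\in X$ adjacent, and $U=U(x,y)$ as in the context. Then for all $u,v\in U$ we have $u\circ v\in U$, where $\circ$ is the entrywise product on $\mathbb C^X$.
   Context: Adjacency in $\Gamma$: $\mathrm{rank}(z-w)=1$; distance $\partial(z,w)=\mathrm{rank}(z-w)$; $\Gamma_i(z)=\{w:\partial(z,w)=i\}$ (empty for $i<0$ or $i>D$), $\Gamma(z)=\Gamma_1(z)$. The $(x,y)$-partition of $X$ consists of the following $6D-2$ sets (nonempty, partitioning $X$): for $1\le i\le D$, $O_{i,i-1}=\Gamma_i(x)\cap\Gamma_{i-1}(y)$, $O_{i-1,i}=\Gamma_{i-1}(x)\cap\Gamma_i(y)$; for $z\in\Gamma_i(x)\cap\Gamma_i(y)$ let $m^-(z)=|\Gamma(x)\cap\Gamma(y)\cap\Gamma_{i-1}(z)|$, $m^+(z)=|\Gamma(x)\cap\Gamma(y)\cap\Gamma_{i+1}(z)|$; $O^A_{i,i}$ ($2\le i\le D$), $O^B_{i,i}$ ($1\le i\le D$), $O^C_{i,i}$ ($1\le i\le D$), $O^D_{i,i}$ ($1\le i\le D-1$) are the sets of $z\in\Gamma_i(x)\cap\Gamma_i(y)$ with $(m^-(z),m^+(z))$ equal to $(2q^{i-1},0)$, $(2q^{i-1}-1,0)$, $(q^{i-1},q^D-q^i)$, $(q^{i-1},q^{N-D}-q^i)$ respectively.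 $V=\mathbb C^X$; $\hat z$ is the standard basis vector of $z\in X$; $U$ is the span of the characteristic vectors $\sum_{z\in S}\hat z$ of the cells $S$ of the $(x,y)$-partition. For $u=\sum_zu_z\hat z$, $v=\sum_zv_z\hat z$, $u\circ v=\sum_zu_zv_z\hat z$. -}

module Defs where

open import Level using (Level; 0ℓ; _⊔_)
open import Data.Nat using (ℕ; zero; suc; _∸_; _^_) renaming (_*_ to _*ℕ_; _+_ to _+ℕ_)
open import Data.Fin using (Fin; toℕ)
open import Data.Vec using (Vec; []; _∷_; lookup; zipWith; replicate; map)
open import Data.List using (List; []; _∷_; _++_; foldr)
import Data.List as L
open import Data.Fin.Base using () renaming (zero to fz; suc to fs)
open import Data.Product using (Σ; ∃; _×_; _,_)
open import Relation.Nullary using (¬_)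
open import Relation.Binary.PropositionalEquality using (_≡_)
open import Algebra.Bundles using (CommutativeRing)
open import Algebra.Structures using (IsCommutativeRing)

-- A field structure on the finite set Fin q (with propositional equality).
-- Every finite field of order q (i.e. GF(q)) is isomorphic to such a structure.
record FiniteField (q : ℕ) : Set where
  field
    _+F_ _*F_ : Fin q → Fin q → Fin q
    -F_ : Fin q → Fin q
    0F 1F : Fin q
    isCommutativeRing : IsCommutativeRing _≡_ _+F_ _*F_ -F_ 0F 1F
    0≢1 : ¬ (0F ≡ 1F)
    inverse : ∀ a → ¬ (a ≡ 0F) → ∃ λ b → (a *F b) ≡ 1F

-- A (setoid-based) field: a commutative ring with 0 ≉ 1 in which every
-- nonzero element has a multiplicative inverse.  (Stand-in for ℂ.)
record Field (c ℓ : Level) : Set (Level.suc (c ⊔ ℓ)) where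
  field
    commutativeRing : CommutativeRing c ℓ
  open CommutativeRing commutativeRing public
  field
    0≉1 : ¬ (0# ≈ 1#)
    inverse : ∀ a → ¬ (a ≈ 0#) → ∃ λ b → (a * b) ≈ 1#

module Bilinear {q : ℕ} (F : FiniteField q) where
  open FiniteField F

  Row : ℕ → Set
  Row M = Vec (Fin q) M

  Mat : ℕ → ℕ → Set
  Mat D M = Vec (Row M) D

  _-M_ : ∀ {D M} → Mat D M → Mat D M → Mat D M
  A -M B = zipWith (zipWith (λ a b → a +F (-F b))) A B

  zeroRow : ∀ {M} → Row M
  zeroRow = replicate _ 0F

  _+R_ : ∀ {M} → Row M → Row M → Row M
  _+R_ = zipWith _+F_

  _·R_ : ∀ {M} → Fin q → Row M → Row M
  c ·R v = map (c *F_) v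

  linComb : ∀ {D M} (A : Mat D M) (r : ℕ) → (Fin r → Fin D) → (Fin r → Fin q) → Row M
  linComb A zero    ι c = zeroRow
  linComb A (suc r) ι c = (c fz ·R lookup A (ι fz)) +R linComb A r (λ j → ι (fs j)) (λ j → c (fs j))

  Indep : ∀ {D M} (A : Mat D M) (r : ℕ) → (Fin r → Fin D) → Set
  Indep A r ι = ∀ c → linComb A r ι c ≡ zeroRow → ∀ j → c j ≡ 0F

  HasRank : ∀ {D M} → Mat D M → ℕ → Set
  HasRank {D} A r = (Σ (Fin r → Fin D) λ ι → Indep A r ι)
                  × (∀ (ι : Fin (suc r) → Fin D) → ¬ Indep A (suc r) ι)

  Dist : ∀ {D M} → Mat D M → Mat D M → ℕ → Set
  Dist z w i = HasRank (z -M w) i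

HasSize : {X : Set} → (X → Set) → ℕ → Set
HasSize {X} P m =
  Σ (Fin m → X) λ f →
    (∀ a b → f a ≡ f b → a ≡ b) × (∀ a → P (f a)) × (∀ z → P z → ∃ λ a → f a ≡ z)

-- Index conventions (i is the paper's index):
--   out k  : O_{i,i-1},  i = toℕ k +ℕ 1      (1 ≤ i ≤ D)
--   inn k  : O_{i-1,i},  i = toℕ k +ℕ 1      (1 ≤ i ≤ D)
--   cA k   : O^A_{i,i},  i = toℕ k +ℕ 2      (2 ≤ i ≤ D)
--   cB k   : O^B_{i,i},  i = toℕ k +ℕ 1      (1 ≤ i ≤ D)
--   cC k   : O^C_{i,i},  i = toℕ k +ℕ 1      (1 ≤ i ≤ D)
--   cD k   : O^D_{i,i},  i = toℕ k +ℕ 1      (1 ≤ i ≤ D-1)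

data Cell (D : ℕ) : Set where
  out inn cB cC : Fin D → Cell D
  cA cD : Fin (D ∸ 1) → Cell D

allCells : (D : ℕ) → List (Cell D)
allCells D = L.map out (L.allFin D) ++ L.map inn (L.allFin D) ++ L.map cA (L.allFin (D ∸ 1))
          ++ L.map cB (L.allFin D) ++ L.map cC (L.allFin D) ++ L.map cD (L.allFin (D ∸ 1))

module Partition {q : ℕ} (F : FiniteField q) (D N : ℕ) where
  open Bilinear F public

  X : Set
  X = Mat D (N ∸ D)

  module _ (x y : X) where
    Mminus Mplus : ℕ → X → X → Set
    Mminus i z w = Dist x w 1 × Dist y w 1 × Dist z w (i ∸ 1)
    Mplus  i z w = Dist x w 1 × Dist y w 1 × Dist z w (suc i)

    Diag : ℕ → ℕ → ℕ → X → Set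
    Diag i a b z = Dist x z i × Dist y z i × HasSize (Mminus i z) a × HasSize (Mplus i z) b

    InCell : Cell D → X → Set
    InCell (out k) z = Dist x z (toℕ k +ℕ 1) × Dist y z (toℕ k)
    InCell (inn k) z = Dist x z (toℕ k) × Dist y z (toℕ k +ℕ 1)
    InCell (cA k) z = let i = toℕ k +ℕ 2 in Diag i (2 *ℕ q ^ (i ∸ 1)) 0 z
    InCell (cB k) z = let i = toℕ k +ℕ 1 in Diag i (2 *ℕ q ^ (i ∸ 1) ∸ 1) 0 z
    InCell (cC k) z = let i = toℕ k +ℕ 1 in Diag i (q ^ (i ∸ 1)) (q ^ D ∸ q ^ i) z
    InCell (cD k) z = let i = toℕ k +ℕ 1 in Diag i (q ^ (i ∸ 1)) (q ^ (N ∸ D) ∸ q ^ i) z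

  module Vectors {c ℓ : Level} (K : Field c ℓ) where
    open Field K

    V : Set c
    V = X → Carrier

    _∘V_ : V → V → V
    (u ∘V v) z = u z * v z

    IsCharVecs : (x y : X) → (Cell D → V) → Set ℓ
    IsCharVecs x y χ = ∀ S z → (InCell x y S z → χ S z ≈ 1#) × (¬ InCell x y S z → χ S z ≈ 0#)

    InSpan : (Cell D → V) → V → Set (c ⊔ ℓ)
    InSpan χ u = Σ (Cell D → Carrier) λ a →
      ∀ z → u z ≈ foldr (λ S acc → (a S * χ S z) + acc) 0# (allCells D)

{-# OPTIONS --safe #-}
-- Characteristic vectors of pairwise disjoint sets multiply pointwise like orthogonal
-- idempotents, so their span is closed under ∘, and everything reduces to the disjointness
-- of the cells of the (x,y)-partition.  A cell is pinned down by the signature of its points: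
-- the distances ∂(x,z), ∂(y,z) and, on the diagonal, the counts (m⁻(z), m⁺(z)).  Rank and
-- cardinality are unique, and for q > 1 and 2 ≤ D < N - D the four count pairs prescribed
-- for O^A, O^B, O^C, O^D at the same i are pairwise different, so distinct cells have
-- distinct signatures.  Cell membership is decidable, since all its quantifiers range over
-- finite sets; this is what lets χ_S(z) be treated as 0 or 1.
-- Of the hypotheses on q and x, y only q > 1 is used: q ≠ 2 and ∂(x,y) = 1 concern the cells
-- forming a partition of X into nonempty sets, which closure under ∘ does not need.
module Submission where

open import Defs
open import Level using (Level)
open import Data.Nat using (ℕ; suc; _*_; _<_; _≤_; _^_)
open import Data.Nat.Primality using (Prime)
open import Data.Product using (∃; _×_)
open import Relation.Nullary using (¬_)
open import Relation.Binary.PropositionalEquality using (_≡_)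

open import Function using (_∘_; id)
open import Data.Nat using (zero; _+_; _∸_; _≤′_; ≤′-refl; ≤′-step; z≤n; s≤s; z<s; NonZero; >-nonZero; nonTrivial⇒n>1)
import Data.Nat.Properties as ℕ
open import Data.Nat.Primality using (prime⇒nonTrivial)
open import Algebra.Bundles using (Semiring)
open import Relation.Binary.Bundles using (Setoid)
open import Data.Fin using (Fin; toℕ) renaming (zero to fzero; suc to fsuc)
import Data.Fin.Properties as Fin
open import Data.Vec using (Vec; []; _∷_; lookup; tabulate)
import Data.Vec.Properties as Vec
import Data.Vec.Functional as Vector
open import Data.Product using (_,_; proj₁; proj₂; curry; uncurry)
open import Data.Empty using (⊥-elim)
open import Data.Unit using (⊤; tt)
open import Data.List using (List; []; _∷_; _++_)
import Data.List as List
open import Data.List.Relation.Unary.All using (All; []; _∷_)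
import Data.List.Relation.Unary.All as All
import Data.List.Relation.Unary.All.Properties as All
open import Data.List.Relation.Unary.AllPairs using (AllPairs; []; _∷_)
import Data.List.Relation.Unary.AllPairs as AllPairs
import Data.List.Relation.Unary.AllPairs.Properties as AllPairs
open import Relation.Nullary using (Dec; yes; no; contradiction)
open import Relation.Nullary.Decidable using (map′; ¬?; _×-dec_; _→-dec_; decidable-stable)
open import Relation.Unary using (Decidable)
open import Relation.Binary.Definitions using (DecidableEquality)
open import Relation.Binary.PropositionalEquality using (_≢_; refl; sym; trans; cong; cong₂; subst; _≗_)

Exhaustible : Set → Set₁
Exhaustible A = ∀ {P : A → Set} → Decidable P → Dec (∃ P)

Extensional : ∀ {A B : Set} → ((A → B) → Set) → Set
Extensional P = ∀ {f g} → f ≗ g → P f → P g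

module _ {A : Set} {P : A → Set} where

  ¬∃¬⇒∀? : Decidable P → Dec (∃ (¬_ ∘ P)) → Dec (∀ a → P a)
  ¬∃¬⇒∀? P? = map′ (λ ∄¬P a → decidable-stable (P? a) (curry ∄¬P a)) (λ ∀P (a , ¬Pa) → ¬Pa (∀P a)) ∘ ¬?

  ∀? : Exhaustible A → Decidable P → Dec (∀ a → P a)
  ∀? exhaustible P? = ¬∃¬⇒∀? P? (exhaustible (¬? ∘ P?))

Vec-exhaustible : ∀ {A} → Exhaustible A → ∀ n → Exhaustible (Vec A n)
Vec-exhaustible exhaustible zero P? = map′ ([] ,_) (λ { ([] , p) → p }) (P? [])
Vec-exhaustible exhaustible (suc n) P? =
  map′ (λ (a , v , p) → a ∷ v , p) (λ { (a ∷ v , p) → a , v , p })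
       (exhaustible (λ a → Vec-exhaustible exhaustible n (P? ∘ (a ∷_))))

module _ {A : Set} (exhaustible : Exhaustible A) {n : ℕ} where

  Π-∃? : {P : (Fin n → A) → Set} → Extensional P → Decidable P → Dec (∃ P)
  Π-∃? ext P? = map′ (λ (v , p) → lookup v , p) (λ (f , p) → tabulate f , ext (sym ∘ Vec.lookup∘tabulate f) p)
                     (Vec-exhaustible exhaustible n (P? ∘ lookup))

  Π-∀? : {P : (Fin n → A) → Set} → Extensional P → Decidable P → Dec (∀ f → P f)
  Π-∀? ext P? = ¬∃¬⇒∀? P? (Π-∃? (λ f≗g ¬Pf → ¬Pf ∘ ext (sym ∘ f≗g)) (¬? ∘ P?))

module Rank {q : ℕ} (F : FiniteField q) where
  open Bilinear F
  open FiniteField F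
  open import Algebra.Structures using (IsCommutativeRing)
  open IsCommutativeRing isCommutativeRing using (zeroˡ; +-identityʳ)

  Independent : ∀ {D M} → Mat D M → ℕ → Set
  Independent A r = ∃ (Indep A r)

  0·v+0≡0 : ∀ {M} (v : Row M) → (0F ·R v) +R zeroRow ≡ zeroRow
  0·v+0≡0 [] = refl
  0·v+0≡0 (a ∷ v) = cong₂ _∷_ (trans (+-identityʳ _) (zeroˡ a)) (0·v+0≡0 v)

  Indep-tail : ∀ {D M} {A : Mat D M} {r ι} → Indep A (suc r) ι → Indep A r (ι ∘ fsuc)
  Indep-tail {A = A} {ι = ι} indep c ∑≡0 j =
    indep (0F Vector.∷ c) (trans (cong ((0F ·R lookup A (ι fzero)) +R_) ∑≡0) (0·v+0≡0 _)) (fsuc j)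

  Independent-≤′ : ∀ {D M} {A : Mat D M} {m n} → m ≤′ n → Independent A n → Independent A m
  Independent-≤′ ≤′-refl independent = independent
  Independent-≤′ (≤′-step m≤′n) (ι , indep) = Independent-≤′ m≤′n (ι ∘ fsuc , Indep-tail {ι = ι} indep)

  HasRank-maximal : ∀ {D M} {A : Mat D M} {r s} → HasRank A r → Independent A s → s ≤ r
  HasRank-maximal (_ , maximal) independent = ℕ.≮⇒≥ λ r<s →
    let (ι , indep) = Independent-≤′ (ℕ.≤⇒≤′ r<s) independent in maximal ι indep

  HasRank-unique : ∀ {D M} (A : Mat D M) {r s} → HasRank A r → HasRank A s → r ≡ s
  HasRank-unique _ rank-r rank-s = ℕ.≤-antisym (HasRank-maximal rank-s (proj₁ rank-r)) (HasRank-maximal rank-r (proj₁ rank-s))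

  linComb-cong : ∀ {D M} (A : Mat D M) r {ι ι' c c'} → ι ≗ ι' → c ≗ c' → linComb A r ι c ≡ linComb A r ι' c'
  linComb-cong A zero ι≗ι' c≗c' = refl
  linComb-cong A (suc r) ι≗ι' c≗c' =
    cong₂ _+R_ (cong₂ _·R_ (c≗c' fzero) (cong (lookup A) (ι≗ι' fzero)))
               (linComb-cong A r (ι≗ι' ∘ fsuc) (c≗c' ∘ fsuc))

  Indep-ext : ∀ {D M} (A : Mat D M) r → Extensional (Indep A r)
  Indep-ext A r {ι} {ι'} ι≗ι' indep c ∑≡0 = indep c (trans (linComb-cong A r {ι} {ι'} ι≗ι' (λ _ → refl)) ∑≡0)

  Indep? : ∀ {D M} (A : Mat D M) r → Decidable (Indep A r)
  Indep? A r ι = Π-∀? Fin.any? ext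
    (λ c → Vec.≡-dec Fin._≟_ (linComb A r ι c) zeroRow →-dec Fin.all? (λ j → c j Fin.≟ 0F))
    where
      ext : Extensional (λ c → linComb A r ι c ≡ zeroRow → ∀ j → c j ≡ 0F)
      ext c≗c' trivial ∑≡0 j = trans (sym (c≗c' j)) (trivial (trans (linComb-cong A r (λ _ → refl) c≗c') ∑≡0) j)

  HasRank? : ∀ {D M} (A : Mat D M) r → Dec (HasRank A r)
  HasRank? A r = Π-∃? Fin.any? (Indep-ext A r) (Indep? A r)
           ×-dec map′ curry uncurry (¬? (Π-∃? Fin.any? (Indep-ext A (suc r)) (Indep? A (suc r))))

module _ {X : Set} {P : X → Set} where

  HasSize⇒≤ : ∀ {m n} → HasSize P m → HasSize P n → m ≤ n
  HasSize⇒≤ (f , f-injective , f-into , _) (g , _ , _ , g-onto) = Fin.injective⇒≤ preimage-injective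
    where
      preimage : Fin _ → Fin _
      preimage a = proj₁ (g-onto (f a) (f-into a))

      preimage-injective : ∀ {a b} → preimage a ≡ preimage b → a ≡ b
      preimage-injective {a} {b} eq = f-injective a b
        (trans (sym (proj₂ (g-onto (f a) (f-into a)))) (trans (cong g eq) (proj₂ (g-onto (f b) (f-into b)))))

  HasSize-unique : ∀ {m n} → HasSize P m → HasSize P n → m ≡ n
  HasSize-unique size-m size-n = ℕ.≤-antisym (HasSize⇒≤ size-m size-n) (HasSize⇒≤ size-n size-m)

  HasSize? : Exhaustible X → DecidableEquality X → Decidable P → ∀ m → Dec (HasSize P m)
  HasSize? exhaustible _≟_ P? m = Π-∃? exhaustible ext λ f →
        Fin.all? (λ a → Fin.all? λ b → (f a ≟ f b) →-dec (a Fin.≟ b))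
    ×-dec Fin.all? (P? ∘ f)
    ×-dec ∀? exhaustible (λ z → P? z →-dec Fin.any? (λ a → f a ≟ z))
    where
      ext : Extensional {Fin m} (λ f → (∀ a b → f a ≡ f b → a ≡ b) × (∀ a → P (f a)) × (∀ z → P z → ∃ λ a → f a ≡ z))
      ext {f} {g} f≗g (f-injective , f-into , f-onto) =
          (λ a b eq → f-injective a b (trans (f≗g a) (trans eq (sym (f≗g b)))))
        , (λ a → subst P (f≗g a) (f-into a))
        , (λ z Pz → let (a , fa≡z) = f-onto z Pz in a , trans (sym (f≗g a)) fa≡z)

data DiagonalType : Set where
  ᴬ ᴮ ᶜ ᴰ : DiagonalType

module DiagonalCounts (q d e : ℕ) where

  m⁻ m⁺ : DiagonalType → ℕ → ℕ
  m⁻ ᴬ i = 2 * q ^ (i ∸ 1)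
  m⁻ ᴮ i = 2 * q ^ (i ∸ 1) ∸ 1
  m⁻ ᶜ i = q ^ (i ∸ 1)
  m⁻ ᴰ i = q ^ (i ∸ 1)
  m⁺ ᴬ i = 0
  m⁺ ᴮ i = 0
  m⁺ ᶜ i = q ^ d ∸ q ^ i
  m⁺ ᴰ i = q ^ e ∸ q ^ i

  2n∸1≡n⇒n≤1 : ∀ n → 2 * n ∸ 1 ≡ n → n ≤ 1
  2n∸1≡n⇒n≤1 zero _ = z≤n
  2n∸1≡n⇒n≤1 (suc zero) _ = ℕ.≤-refl
  2n∸1≡n⇒n≤1 (suc (suc k)) eq =
    ⊥-elim (ℕ.m+1+n≢m k (ℕ.suc-injective (trans (sym (ℕ.+-suc k _)) (ℕ.suc-injective eq))))

  module _ (1<q : 1 < q) (1<d : 1 < d) (d<e : d < e) where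
    instance
      q-nonZero : NonZero q
      q-nonZero = >-nonZero (ℕ.<-trans z<s 1<q)

    0<q^n : ∀ n → 0 < q ^ n
    0<q^n = ℕ.m^n>0 q

    m⁻ᴮ<m⁻ᴬ : ∀ i → m⁻ ᴮ i < m⁻ ᴬ i
    m⁻ᴮ<m⁻ᴬ i = ℕ.∸-monoʳ-< z<s (ℕ.≤-trans (0<q^n (i ∸ 1)) (ℕ.m≤m+n _ _))

    m⁻ᶜ<m⁻ᴬ : ∀ i → m⁻ ᶜ i < m⁻ ᴬ i
    m⁻ᶜ<m⁻ᴬ i = ℕ.m<m+n _ (ℕ.m≤n⇒m≤n+o 0 (0<q^n (i ∸ 1)))

    m⁻ᴮ≡m⁻ᶜ⇒i≤1 : ∀ i → m⁻ ᴮ i ≡ m⁻ ᶜ i → i ≤ 1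
    m⁻ᴮ≡m⁻ᶜ⇒i≤1 i eq = ℕ.m∸n≡0⇒m≤n (ℕ.n≤0⇒n≡0 (ℕ.≮⇒≥ λ 0<i∸1 →
      ℕ.<⇒≱ (ℕ.^-monoʳ-< q 1<q 0<i∸1) (2n∸1≡n⇒n≤1 (q ^ (i ∸ 1)) eq)))

    i≤1⇒0<q^f∸q^i : ∀ {i f} → 1 < f → i ≤ 1 → 0 < q ^ f ∸ q ^ i
    i≤1⇒0<q^f∸q^i 1<f i≤1 = ℕ.m<n⇒0<n∸m (ℕ.≤-<-trans (ℕ.^-monoʳ-≤ q i≤1) (ℕ.^-monoʳ-< q 1<q 1<f))

    m⁺ᴮ≢m⁺ᶜ : ∀ i → m⁻ ᴮ i ≡ m⁻ ᶜ i → m⁺ ᴮ i ≢ m⁺ ᶜ i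
    m⁺ᴮ≢m⁺ᶜ i eq = ℕ.<⇒≢ (i≤1⇒0<q^f∸q^i 1<d (m⁻ᴮ≡m⁻ᶜ⇒i≤1 i eq))

    m⁺ᴮ≢m⁺ᴰ : ∀ i → m⁻ ᴮ i ≡ m⁻ ᴰ i → m⁺ ᴮ i ≢ m⁺ ᴰ i
    m⁺ᴮ≢m⁺ᴰ i eq = ℕ.<⇒≢ (i≤1⇒0<q^f∸q^i (ℕ.<-trans 1<d d<e) (m⁻ᴮ≡m⁻ᶜ⇒i≤1 i eq))

    m⁺ᶜ≢m⁺ᴰ : ∀ {i} → i ≤ d → m⁺ ᶜ i ≢ m⁺ ᴰ i
    m⁺ᶜ≢m⁺ᴰ i≤d eq = ℕ.<⇒≢ (ℕ.^-monoʳ-< q 1<q d<e)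
      (ℕ.∸-cancelʳ-≡ (ℕ.^-monoʳ-≤ q i≤d) (ℕ.^-monoʳ-≤ q (ℕ.≤-trans i≤d (ℕ.<⇒≤ d<e))) eq)

    DiagonalType-unique : ∀ {i} κ κ' → i ≤ d → m⁻ κ i ≡ m⁻ κ' i → m⁺ κ i ≡ m⁺ κ' i → κ ≡ κ'
    DiagonalType-unique {i} ᴬ ᴬ _ _ _ = refl
    DiagonalType-unique {i} ᴬ ᴮ _ m⁻≡ _ = contradiction m⁻≡ (ℕ.>⇒≢ (m⁻ᴮ<m⁻ᴬ i))
    DiagonalType-unique {i} ᴬ ᶜ _ m⁻≡ _ = contradiction m⁻≡ (ℕ.>⇒≢ (m⁻ᶜ<m⁻ᴬ i))
    DiagonalType-unique {i} ᴬ ᴰ _ m⁻≡ _ = contradiction m⁻≡ (ℕ.>⇒≢ (m⁻ᶜ<m⁻ᴬ i))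
    DiagonalType-unique {i} ᴮ ᴬ _ m⁻≡ _ = contradiction m⁻≡ (ℕ.<⇒≢ (m⁻ᴮ<m⁻ᴬ i))
    DiagonalType-unique {i} ᴮ ᴮ _ _ _ = refl
    DiagonalType-unique {i} ᴮ ᶜ _ m⁻≡ m⁺≡ = contradiction m⁺≡ (m⁺ᴮ≢m⁺ᶜ i m⁻≡)
    DiagonalType-unique {i} ᴮ ᴰ _ m⁻≡ m⁺≡ = contradiction m⁺≡ (m⁺ᴮ≢m⁺ᴰ i m⁻≡)
    DiagonalType-unique {i} ᶜ ᴬ _ m⁻≡ _ = contradiction m⁻≡ (ℕ.<⇒≢ (m⁻ᶜ<m⁻ᴬ i))
    DiagonalType-unique {i} ᶜ ᴮ _ m⁻≡ m⁺≡ = contradiction (sym m⁺≡) (m⁺ᴮ≢m⁺ᶜ i (sym m⁻≡))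
    DiagonalType-unique {i} ᶜ ᶜ _ _ _ = refl
    DiagonalType-unique {i} ᶜ ᴰ i≤d _ m⁺≡ = contradiction m⁺≡ (m⁺ᶜ≢m⁺ᴰ i≤d)
    DiagonalType-unique {i} ᴰ ᴬ _ m⁻≡ _ = contradiction m⁻≡ (ℕ.<⇒≢ (m⁻ᶜ<m⁻ᴬ i))
    DiagonalType-unique {i} ᴰ ᴮ _ m⁻≡ m⁺≡ = contradiction (sym m⁺≡) (m⁺ᴮ≢m⁺ᴰ i (sym m⁻≡))
    DiagonalType-unique {i} ᴰ ᶜ i≤d _ m⁺≡ = contradiction (sym m⁺≡) (m⁺ᶜ≢m⁺ᴰ i≤d)
    DiagonalType-unique {i} ᴰ ᴰ _ _ _ = refl

AtMostOne : ∀ {A : Set} → (A → Set) → List A → Set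
AtMostOne P = AllPairs (λ S T → ¬ (P S × P T))

-- farFromX i, farFromY i and diagonal κ i stand for O_{i+1,i}, O_{i,i+1} and O^κ_{i,i}.
data Signature : Set where
  farFromX farFromY : ℕ → Signature
  diagonal : DiagonalType → ℕ → Signature

index tag : Signature → ℕ
index (farFromX i) = i
index (farFromY i) = i
index (diagonal _ i) = i
tag (farFromX _) = 0
tag (farFromY _) = 1
tag (diagonal ᴬ _) = 2
tag (diagonal ᴮ _) = 3
tag (diagonal ᶜ _) = 4
tag (diagonal ᴰ _) = 5

toℕ+1+o≤n : ∀ {n} o (k : Fin (n ∸ o)) → toℕ k + suc o ≤ n
toℕ+1+o≤n {n} zero k = subst (_≤ n) (ℕ.+-comm 1 (toℕ k)) (Fin.toℕ<n k)
toℕ+1+o≤n {suc n} (suc o) k = subst (_≤ suc n) (sym (ℕ.+-suc (toℕ k) (suc o))) (s≤s (toℕ+1+o≤n o k))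

m+1≢m : ∀ m → m + 1 ≢ m
m+1≢m m = ℕ.m+1+n≢m m

m+1≡n⇒n+1≢m : ∀ {m n} → m + 1 ≡ n → n + 1 ≢ m
m+1≡n⇒n+1≢m {m} {n} m+1≡n n+1≡m =
  ℕ.<-asym (subst (m <_) m+1≡n (ℕ.m<m+n m z<s)) (subst (n <_) n+1≡m (ℕ.m<m+n n z<s))

module Signatures {q : ℕ} (F : FiniteField q) (D N : ℕ) where
  open Partition F D N
  open Rank F
  open DiagonalCounts q D (N ∸ D)

  signature : Cell D → Signature
  signature (out k) = farFromX (toℕ k)
  signature (inn k) = farFromY (toℕ k)
  signature (cA k) = diagonal ᴬ (toℕ k + 2)
  signature (cB k) = diagonal ᴮ (toℕ k + 1)
  signature (cC k) = diagonal ᶜ (toℕ k + 1)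
  signature (cD k) = diagonal ᴰ (toℕ k + 1)

  -- Realised diagonal indices are ranks, hence at most D, but reading the bound off the cell
  -- index is simpler.  It is needed only to separate ᶜ from ᴰ, whose m⁺ both truncate to 0
  -- once i ≥ N - D.
  Bounded : Signature → Set
  Bounded (diagonal _ i) = i ≤ D
  Bounded _ = ⊤

  signature-bounded : ∀ S → Bounded (signature S)
  signature-bounded (out k) = tt
  signature-bounded (inn k) = tt
  signature-bounded (cA k) = toℕ+1+o≤n 1 k
  signature-bounded (cB k) = toℕ+1+o≤n 0 k
  signature-bounded (cC k) = toℕ+1+o≤n 0 k
  signature-bounded (cD k) = ℕ.≤-trans (ℕ.+-monoʳ-≤ (toℕ k) (ℕ.n≤1+n 1)) (toℕ+1+o≤n 1 k)

  DistinctSignatures : Cell D → Cell D → Set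
  DistinctSignatures S T = signature S ≢ signature T

  TaggedFrom : ℕ → List (Cell D) → Set
  TaggedFrom t L = AllPairs DistinctSignatures L × All (λ S → t ≤ tag (signature S)) L

  module _ {m t} (c : Fin m → Cell D) (c-injective : ∀ {k k'} → signature (c k) ≡ signature (c k') → k ≡ k')
           (c-tag : ∀ k → tag (signature (c k)) ≡ t) where

    block-tagged : TaggedFrom t (List.map c (List.allFin m))
    block-tagged = AllPairs.map⁺ (AllPairs.tabulate⁺ (λ k≢k' → k≢k' ∘ c-injective))
                 , All.map⁺ (All.universal (λ k → ℕ.≤-reflexive (sym (c-tag k))) _)

    block-++ : ∀ {L} → TaggedFrom (suc t) L → TaggedFrom t (List.map c (List.allFin m) ++ L)
    block-++ (distinct , above) =
        AllPairs.++⁺ (proj₁ block-tagged) distinct (All.map⁺ (All.universal (λ k → All.map (λ t<tag eq →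
          ℕ.<⇒≢ t<tag (trans (sym (c-tag k)) (cong tag eq))) above) _))
      , All.++⁺ (proj₂ block-tagged) (All.map ℕ.<⇒≤ above)

  allCells-distinctSignatures : AllPairs DistinctSignatures (allCells D)
  allCells-distinctSignatures = proj₁
    (block-++ out (Fin.toℕ-injective ∘ cong index) (λ _ → refl)
    (block-++ inn (Fin.toℕ-injective ∘ cong index) (λ _ → refl)
    (block-++ cA (Fin.toℕ-injective ∘ ℕ.+-cancelʳ-≡ 2 _ _ ∘ cong index) (λ _ → refl)
    (block-++ cB (Fin.toℕ-injective ∘ ℕ.+-cancelʳ-≡ 1 _ _ ∘ cong index) (λ _ → refl)
    (block-++ cC (Fin.toℕ-injective ∘ ℕ.+-cancelʳ-≡ 1 _ _ ∘ cong index) (λ _ → refl)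
    (block-tagged cD (Fin.toℕ-injective ∘ ℕ.+-cancelʳ-≡ 1 _ _ ∘ cong index) (λ _ → refl)))))))

  X-exhaustible : Exhaustible X
  X-exhaustible = Vec-exhaustible (Vec-exhaustible Fin.any? (N ∸ D)) D

  _≟X_ : DecidableEquality X
  _≟X_ = Vec.≡-dec (Vec.≡-dec Fin._≟_)

  Dist? : ∀ (z w : X) i → Dec (Dist z w i)
  Dist? z w = HasRank? (z -M w)

  module _ (x y : X) where

    Realises : X → Signature → Set
    Realises z (farFromX i) = Dist x z (i + 1) × Dist y z i
    Realises z (farFromY i) = Dist x z i × Dist y z (i + 1)
    Realises z (diagonal κ i) = Diag x y i (m⁻ κ i) (m⁺ κ i) z

    InCell≡Realises : ∀ S z → InCell x y S z ≡ Realises z (signature S)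
    InCell≡Realises (out k) z = refl
    InCell≡Realises (inn k) z = refl
    InCell≡Realises (cA k) z = refl
    InCell≡Realises (cB k) z = refl
    InCell≡Realises (cC k) z = refl
    InCell≡Realises (cD k) z = refl

    Realises? : ∀ z s → Dec (Realises z s)
    Realises? z (farFromX i) = Dist? x z (i + 1) ×-dec Dist? y z i
    Realises? z (farFromY i) = Dist? x z i ×-dec Dist? y z (i + 1)
    Realises? z (diagonal κ i) = Dist? x z i ×-dec Dist? y z i
      ×-dec HasSize? X-exhaustible _≟X_ (λ w → Dist? x w 1 ×-dec Dist? y w 1 ×-dec Dist? z w (i ∸ 1)) (m⁻ κ i)
      ×-dec HasSize? X-exhaustible _≟X_ (λ w → Dist? x w 1 ×-dec Dist? y w 1 ×-dec Dist? z w (suc i)) (m⁺ κ i)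

    InCell? : ∀ z → Decidable (λ S → InCell x y S z)
    InCell? z S = subst Dec (sym (InCell≡Realises S z)) (Realises? z (signature S))

    module _ (1<q : 1 < q) (1<D : 1 < D) (D<N∸D : D < N ∸ D) where

      module _ (z : X) where
        private
          ∂x-unique : ∀ {i j} → Dist x z i → Dist x z j → i ≡ j
          ∂x-unique = HasRank-unique (x -M z)

          ∂y-unique : ∀ {i j} → Dist y z i → Dist y z j → i ≡ j
          ∂y-unique = HasRank-unique (y -M z)

        Realises-unique : ∀ s s' → Bounded s → Realises z s → Realises z s' → s ≡ s'
        Realises-unique (farFromX i) (farFromX j) _ (_ , y-i) (_ , y-j) = cong farFromX (∂y-unique y-i y-j)
        Realises-unique (farFromX i) (farFromY j) _ (x-i , y-i) (x-j , y-j) =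
          ⊥-elim (m+1≡n⇒n+1≢m (∂x-unique x-i x-j) (∂y-unique y-j y-i))
        Realises-unique (farFromX i) (diagonal _ j) _ (x-i , y-i) (x-j , y-j , _) =
          ⊥-elim (m+1≢m i (trans (∂x-unique x-i x-j) (∂y-unique y-j y-i)))
        Realises-unique (farFromY i) (farFromX j) _ (x-i , y-i) (x-j , y-j) =
          ⊥-elim (m+1≡n⇒n+1≢m (∂y-unique y-i y-j) (∂x-unique x-j x-i))
        Realises-unique (farFromY i) (farFromY j) _ (x-i , _) (x-j , _) = cong farFromY (∂x-unique x-i x-j)
        Realises-unique (farFromY i) (diagonal _ j) _ (x-i , y-i) (x-j , y-j , _) =
          ⊥-elim (m+1≢m i (trans (∂y-unique y-i y-j) (∂x-unique x-j x-i)))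
        Realises-unique (diagonal _ i) (farFromX j) _ (x-i , y-i , _) (x-j , y-j) =
          ⊥-elim (m+1≢m j (trans (∂x-unique x-j x-i) (∂y-unique y-i y-j)))
        Realises-unique (diagonal _ i) (farFromY j) _ (x-i , y-i , _) (x-j , y-j) =
          ⊥-elim (m+1≢m j (trans (∂y-unique y-j y-i) (∂x-unique x-i x-j)))
        Realises-unique (diagonal κ i) (diagonal κ' j) i≤D (x-i , _ , m⁻-i , m⁺-i) (x-j , _ , m⁻-j , m⁺-j)
          with ∂x-unique x-i x-j
        ... | refl = cong (λ κ → diagonal κ i)
          (DiagonalType-unique 1<q 1<D D<N∸D κ κ' i≤D (HasSize-unique m⁻-i m⁻-j) (HasSize-unique m⁺-i m⁺-j))

      cells-exclusive : ∀ z → AtMostOne (λ S → InCell x y S z) (allCells D)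
      cells-exclusive z = AllPairs.map (λ {S} {T} S≢T (S∋z , T∋z) → S≢T
        (Realises-unique z (signature S) (signature T) (signature-bounded S)
          (subst id (InCell≡Realises S z) S∋z) (subst id (InCell≡Realises T z) T∋z))) allCells-distinctSignatures

module IndicatorSums {c ℓ} (R : Semiring c ℓ) where
  open Semiring R using (Carrier; _≈_; 0#; 1#; setoid; +-cong; *-cong; *-congˡ; *-identityʳ; zeroˡ; zeroʳ; +-identityˡ; +-identityʳ)
    renaming (_+_ to _⊕_; _*_ to _⊗_)
  open Setoid setoid using () renaming (refl to ≈-refl; sym to ≈-sym; trans to ≈-trans)
  open import Relation.Binary.Reasoning.Setoid setoid

  module _ {A : Set} {P : A → Set} (P? : Decidable P) {e : A → Carrier}
           (e-indicator : ∀ S → (P S → e S ≈ 1#) × (¬ P S → e S ≈ 0#)) where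

    ∑ : (A → Carrier) → List A → Carrier
    ∑ a = List.foldr (λ S acc → a S ⊗ e S ⊕ acc) 0#

    module _ (a : A → Carrier) {S : A} where
      term-present : P S → a S ⊗ e S ≈ a S
      term-present PS = ≈-trans (*-congˡ (proj₁ (e-indicator S) PS)) (*-identityʳ (a S))

      term-absent : ¬ P S → a S ⊗ e S ≈ 0#
      term-absent ¬PS = ≈-trans (*-congˡ (proj₂ (e-indicator S) ¬PS)) (zeroʳ (a S))

    ∑-absent : ∀ a {L} → All (¬_ ∘ P) L → ∑ a L ≈ 0#
    ∑-absent a [] = ≈-refl
    ∑-absent a (¬PS ∷ ¬PL) = ≈-trans (+-cong (term-absent a ¬PS) (∑-absent a ¬PL)) (+-identityʳ 0#)

    ∑-* : ∀ a b {L} → AtMostOne P L → ∑ (λ S → a S ⊗ b S) L ≈ ∑ a L ⊗ ∑ b L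
    ∑-* a b {[]} [] = ≈-sym (zeroˡ 0#)
    ∑-* a b {S ∷ L} (S-excludes ∷ exclusive) with P? S
    ... | yes PS = begin
          a S ⊗ b S ⊗ e S ⊕ ∑ (λ T → a T ⊗ b T) L  ≈⟨ only-S (λ T → a T ⊗ b T) ⟩
          a S ⊗ b S                                ≈⟨ *-cong (only-S a) (only-S b) ⟨
          (a S ⊗ e S ⊕ ∑ a L) ⊗ (b S ⊗ e S ⊕ ∑ b L) ∎
      where
        only-S : ∀ a → a S ⊗ e S ⊕ ∑ a L ≈ a S
        only-S a = ≈-trans (+-cong (term-present a PS) (∑-absent a (All.map (λ excl PT → excl (PS , PT)) S-excludes)))
                         (+-identityʳ (a S))
    ... | no ¬PS = begin
          a S ⊗ b S ⊗ e S ⊕ ∑ (λ T → a T ⊗ b T) L  ≈⟨ +-cong (term-absent (λ T → a T ⊗ b T) ¬PS) (∑-* a b exclusive) ⟩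
          0# ⊕ ∑ a L ⊗ ∑ b L                       ≈⟨ +-identityˡ _ ⟩
          ∑ a L ⊗ ∑ b L                            ≈⟨ *-cong (without-S a) (without-S b) ⟨
          (a S ⊗ e S ⊕ ∑ a L) ⊗ (b S ⊗ e S ⊕ ∑ b L) ∎
      where
        without-S : ∀ a → a S ⊗ e S ⊕ ∑ a L ≈ ∑ a L
        without-S a = ≈-trans (+-cong (term-absent a ¬PS) ≈-refl) (+-identityˡ (∑ a L))

prime-power>1 : ∀ {p k} → Prime p → 1 < p ^ suc k
prime-power>1 {p} {k} p-prime = ℕ.<-≤-trans 1<p (ℕ.m≤m*n p (p ^ k) {{ℕ.m^n≢0 p k {{>-nonZero (ℕ.<-trans z<s 1<p)}}}})
  where
    1<p : 1 < p
    1<p = nonTrivial⇒n>1 p {{prime⇒nonTrivial p-prime}}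

dimension-bounds : ∀ {D N} → 2 * D < N → 6 ≤ 2 * D → 1 < D × D < N ∸ D
dimension-bounds {D} 2D<N 6≤2D =
    ℕ.*-cancelˡ-≤ 2 (ℕ.≤-trans (ℕ.m≤m+n 4 2) 6≤2D)
  , ℕ.m+n≤o⇒m≤o∸n (suc D) (subst (λ t → suc (D + t) ≤ _) (ℕ.+-identityʳ D) 2D<N)

proposition9p3 : ∀ {c ℓ : Level} (q : ℕ) → (∃ λ p → ∃ λ k → Prime p × q ≡ p ^ suc k) → ¬ (q ≡ 2)
    → (F : FiniteField q) → (D N : ℕ) → 2 * D < N → 6 ≤ 2 * D
    → (K : Field c ℓ)
    → let open Partition F D N in let open Vectors K in
      (x y : X) → Dist x y 1
    → (χ : Cell D → V) → IsCharVecs x y χ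
    → ∀ u v → InSpan χ u → InSpan χ v → InSpan χ (u ∘V v)
proposition9p3 q (p , k , p-prime , refl) _ F D N 2D<N 6≤2D K x y _ χ χ-indicator u v (a , u≈) (b , v≈) =
  (λ S → a S K.* b S) , λ z → K.trans (K.*-cong (u≈ z) (v≈ z))
    (K.sym (∑-* (InCell? x y z) (λ S → χ-indicator S z) a b
              (cells-exclusive x y (prime-power>1 {k = k} p-prime) 1<D D<N∸D z)))
  where
    module K = Field K
    open IndicatorSums K.semiring
    open Signatures F D N
    1<D : 1 < D
    1<D = proj₁ (dimension-bounds 2D<N 6≤2D)

    D<N∸D : D < N ∸ D
    D<N∸D = proj₂ (dimension-bounds 2D<N 6≤2D)
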